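{- Let $X\in\sigma\mathcal F$, $Y\le X$ a substructure, $F\in\mathsf{age}(Y)$ and $\alpha\in\omega_1$. If $\alpha\le\mathsf{rk}_Y(F)$, then $\alpha\le\mathsf{rk}_X(F)$. In particular, $\mathsf{rk}_Y(F)\le\mathsf{rk}_X(F)$.
   Context: Let $\mathcal L$ be a countable relational language without constant symbols and $\mathcal F$ a class of finite $\mathcal L$-structures closed under isomorphism and under (induced) substructures. $\sigma\mathcal F$ denotes the class of all countable structures isomorphic to unions of chains of structures in $\mathcal F$ (so substructures of members of $\sigma\mathcal F$ are again in $\sigma\mathcal F$); $\mathsf{age}(X)$ is the set of finite substructures of $X$. If $A\le B$ and $|B\setminus A|=1$, $B$ is a prime extension of $A$. If $A\le B$ and $A\le X$, a realization of $B$ in $X$ is some $C\le X$ with $A\le C$ and an isomorphism $B\to C$ that is the identity on $A$. For $Z\in\sigma\mathcal F$ and $F\in\mathsf{age}(Z)$: $\mathsf{rk}_Z(F)\ge 0$ always; $\mathsf{rk}_Z(F)\ge\alpha+1$ iff every prime extension $B\in\mathcal F$ of $F$ has a realization $C$ in $Z$ with $\mathsf{rk}_Z(C)\ge\alpha$; for limit $\alpha$, $\mathsf{rk}_Z(F)\ge\alpha$ iff $\mathsf{rk}_Z(F)\ge\beta$ for all $\beta<\alpha$; $\mathsf{rk}_Z(F)=\sup\{\alpha:\mathsf{rk}_Z(F)\ge\alpha\}$, with value $\infty$ (larger than every ordinal) if unbounded. -}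

module Defs where

open import Level using (Level) renaming (suc to lsuc; zero to lzero)
open import Data.Nat using (ℕ; zero; suc)
open import Data.Fin using (Fin)
open import Data.Product using (Σ; ∃; ∃-syntax; _×_; _,_)
open import Data.Unit using (⊤)
open import Function using (_∘_)
open import Relation.Binary.PropositionalEquality using (_≡_)

record Language : Set₁ where
  field
    Sym      : Set
    arity    : Sym → ℕ
    code     : Sym → ℕ
    code-inj : ∀ {s t} → code s ≡ code t → s ≡ t
open Language public

record Str (L : Language) (A : Set) : Set₁ where
  field
    rel : (s : Sym L) → (Fin (arity L s) → A) → Set
open Str public

module _ {L : Language} where

  -- (induced-substructure) embeddings: injective, preserve and reflect
  -- every relation.  "A ≤ B" up to identification of A with its image.
  record Emb {A B : Set} (SA : Str L A) (SB : Str L B) : Set where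
    field
      fun     : A → B
      inj     : ∀ {x y} → fun x ≡ fun y → x ≡ y
      preserv : ∀ s (t : Fin (arity L s) → A) → rel SA s t → rel SB s (fun ∘ t)
      reflect : ∀ s (t : Fin (arity L s) → A) → rel SB s (fun ∘ t) → rel SA s t
  open Emb public

  compEmb : {A B C : Set} {SA : Str L A} {SB : Str L B} {SC : Str L C} →
            Emb SB SC → Emb SA SB → Emb SA SC
  compEmb g f = record
    { fun     = fun g ∘ fun f
    ; inj     = λ e → inj f (inj g e)
    ; preserv = λ s t r → preserv g s (fun f ∘ t) (preserv f s t r)
    ; reflect = λ s t r → reflect f s t (reflect g s (fun f ∘ t) r)
    }

  Iso : {A B : Set} → Str L A → Str L B → Set
  Iso SA SB = Σ (Emb SA SB) λ e → ∀ y → ∃[ x ] fun e x ≡ y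

FinStr : Language → ℕ → Set₁
FinStr L n = Str L (Fin n)

Class : Language → Set₁
Class L = ∀ {n} → FinStr L n → Set

module _ {L : Language} where

  IsoClosed : Class L → Set₁
  IsoClosed 𝓕 = ∀ {n} {S T : FinStr L n} → Iso S T → 𝓕 S → 𝓕 T

  HereditaryClass : Class L → Set₁
  HereditaryClass 𝓕 = ∀ {m n} {S : FinStr L m} {T : FinStr L n} →
                      Emb S T → 𝓕 T → 𝓕 S

  -- X ∈ σ𝓕 : X is the union of a chain (C i)_{i ∈ ℕ} of substructures
  -- each lying in 𝓕 (hence X is countable).
  InSigma : Class L → {A : Set} → Str L A → Set₁
  InSigma 𝓕 {A} X =
    Σ (ℕ → ℕ) λ k →
    Σ ((i : ℕ) → FinStr L (k i)) λ C →
    Σ ((i : ℕ) → Emb (C i) X) λ e →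
      (∀ i → 𝓕 (C i))
    × (∀ i (a : Fin (k i)) → ∃[ b ] fun (e (suc i)) b ≡ fun (e i) a)
    × (∀ (x : A) → ∃[ i ] ∃[ a ] fun (e i) a ≡ x)

-- Countable ordinals (elements of ω₁) as Brouwer trees

data Ord : Set where
  zeroO : Ord
  sucO  : Ord → Ord
  limO  : (ℕ → Ord) → Ord

-- A finite substructure F of Z is given by a finite structure
-- with an embedding ι : F ↪ Z.  RkGe 𝓕 Z F ι α  means  α ≤ rk_Z(F).
--  * successor: every prime extension B ∈ 𝓕 of F (B has exactly one more
--    point: carrier Fin (suc n), with F ↪ B) has a realization in Z
--    (an embedding g : B ↪ Z that is the identity on F) of rank ≥ α;
--  * limit: ≥ every member of the fundamental sequence.

module _ {L : Language} (𝓕 : Class L) where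

  RkGe : {A : Set} (Z : Str L A) {n : ℕ} (F : FinStr L n) → Emb F Z → Ord → Set₁
  RkGe Z F ι zeroO    = Level.Lift _ ⊤
  RkGe Z {n} F ι (sucO α) =
    (B : FinStr L (suc n)) → 𝓕 B → (j : Emb F B) →
    Σ (Emb B Z) λ g → (∀ a → fun g (fun j a) ≡ fun ι a) × RkGe Z B g α
  RkGe Z F ι (limO f) = ∀ i → RkGe Z F ι (f i)

module Submission where

open import Defs
open import Data.Nat using (ℕ)
open import Data.Product using (_,_)
open import Relation.Binary.PropositionalEquality using (cong)

-- Rank only asks for realizations to exist, and a realization in Y composed
-- with Y ↪ X is a realization in X; induction on α carries this through
-- successor and limit stages.

module _ {L : Language} (𝓕 : Class L) where

  RkGe-extend : {A B : Set} {X : Str L A} {Y : Str L B} (y : Emb Y X) →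
                {n : ℕ} (F : FinStr L n) (ι : Emb F Y) (α : Ord) →
                RkGe 𝓕 Y F ι α → RkGe 𝓕 X F (compEmb y ι) α
  RkGe-extend y F ι zeroO    r = r
  RkGe-extend y F ι (sucO α) r B B∈𝓕 j with r B B∈𝓕 j
  ... | g , g∘j≡ι , rk-g =
    compEmb y g , (λ a → cong (fun y) (g∘j≡ι a)) , RkGe-extend y B g α rk-g
  RkGe-extend y F ι (limO f) r i = RkGe-extend y F ι (f i) (r i)

-- Monotonicity holds for any embedding Y ↪ X.
lemma2p10 : (L : Language) (𝓕 : Class L) → IsoClosed 𝓕 → HereditaryClass 𝓕 →
    {A : Set} (X : Str L A) → InSigma 𝓕 X →
    {B : Set} (Y : Str L B) (y : Emb Y X) →
    {n : ℕ} (F : FinStr L n) (ι : Emb F Y) →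
    (α : Ord) → RkGe 𝓕 Y F ι α → RkGe 𝓕 X F (compEmb y ι) α
lemma2p10 L 𝓕 _ _ X _ Y y = RkGe-extend 𝓕 y
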